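{- If $G$ is the line graph of some multigraph $H$, then $\chi(G)\le \Delta_2(G)+3$.
   Context: The line graph of a multigraph $H$ (possibly with loops and parallel edges) has one vertex for each edge of $H$, two vertices being adjacent iff the corresponding edges share an endpoint. $\Delta_2(G)$ is the maximum, over distinct vertices $u,v$ of $G$, of the number of common neighbors of $u$ and $v$. -}

module Defs where

open import Data.Nat using (ℕ; _⊔_)
open import Data.Bool using (Bool; true; false; _∧_; _∨_; not; T)
open import Data.Fin using (Fin; _≟_)
open import Data.Product using (_×_; _,_; proj₁; proj₂)
open import Data.List using (List; []; _∷_; length; filterᵇ; allFin; concatMap; foldr)
open import Relation.Nullary.Decidable using (⌊_⌋)
open import Relation.Nullary using (¬_)
open import Relation.Binary.PropositionalEquality using (_≡_)
open import Data.Product using (Σ)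

-- A finite multigraph (loops and parallel edges allowed):
-- vertices Fin n, edges Fin m, each edge e has an (unordered) pair of
-- endpoints ends e; a loop is an edge whose two endpoints coincide.
-- Parallel edges are distinct edge indices with the same endpoints.
record Multigraph : Set where
  field
    n    : ℕ
    m    : ℕ
    ends : Fin m → Fin n × Fin n

record Graph : Set where
  field
    k   : ℕ
    adj : Fin k → Fin k → Bool

module _ (H : Multigraph) where
  open Multigraph H

  shareEnd : Fin m → Fin m → Bool
  shareEnd e f with ends e | ends f
  ... | a , b | c , d = ⌊ a ≟ c ⌋ ∨ ⌊ a ≟ d ⌋ ∨ ⌊ b ≟ c ⌋ ∨ ⌊ b ≟ d ⌋

lineGraph : Multigraph → Graph
lineGraph H = record
  { k   = Multigraph.m H
  ; adj = λ e f → not ⌊ e ≟ f ⌋ ∧ shareEnd H e f }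

module _ (G : Graph) where
  open Graph G

  commonNbrs : Fin k → Fin k → ℕ
  commonNbrs u v = length (filterᵇ (λ w → adj u w ∧ adj v w) (allFin k))

  Δ₂ : ℕ
  Δ₂ = foldr _⊔_ 0
         (concatMap (λ u → concatMap (λ v → if? u v) (allFin k)) (allFin k))
    where
    if? : Fin k → Fin k → List ℕ
    if? u v with ⌊ u ≟ v ⌋
    ... | true  = []
    ... | false = commonNbrs u v ∷ []

  ProperColouring : (c : ℕ) → (Fin k → Fin c) → Set
  ProperColouring c col = ∀ u v → T (adj u v) → ¬ (col u ≡ col v)

  Colourable : ℕ → Set
  Colourable c = Σ (Fin k → Fin c) (ProperColouring c)

{-# OPTIONS --safe #-}
-- Any two distinct edges at a vertex have all
-- other edges at that vertex as common neighbours in the line graph, so every vertex has at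
-- most Δ₂ + 2 edges and misses some colour. A loop, or an edge with a parallel twin, shares
-- all its neighbours except the twin with the twin, so it has at most Δ₂ + 1 neighbours;
-- these edges are coloured greedily, last. The simple edges are coloured first, one at a
-- time, by Vizing's argument: rotate a fan of edges at one end x of the uncoloured edge, and
-- when the fan closes up, first swap two colours on the Kempe chain (an alternating path)
-- starting at x.
module Submission where

open import Defs
open import Data.Bool using (Bool; true; false; T; not; _∧_; _∨_)
open import Data.Bool.Properties using (T-∧; T-not-≡)
open import Data.Empty using (⊥; ⊥-elim)
open import Data.Fin using (Fin; zero; suc; _≟_; toℕ; fromℕ<; punchIn)
open import Data.Fin.Permutation.Components using (transpose)
open import Data.Fin.Properties
  using (any?; all?; ¬∀⟶∃¬; injective⇒≤; pigeonhole; punchIn-injective; punchInᵢ≢i; suc-injective;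
         toℕ≤pred[n]; toℕ-fromℕ<)
open import Data.List using (List; []; _∷_; foldr; concatMap; allFin; filterᵇ; length)
open import Data.List.Membership.Propositional using (_∈_; lose)
open import Data.List.Membership.Propositional.Properties using (∈-filter⁺; ∈-allFin)
import Data.List.Membership.Setoid.Properties as SetoidMembership
open import Data.List.Properties using (foldr-preservesᵒ)
open import Data.List.Relation.Unary.Any using (Any; here; there; index)
open import Data.List.Relation.Unary.Any.Properties using (concatMap⁺)
open import Data.Maybe using (Maybe; just; nothing; is-just; fromMaybe; _>>=_)
import Data.Maybe as Maybe
open import Data.Maybe.Properties using (just-injective) renaming (≡-dec to ≡-dec-Maybe)
open import Data.Nat using (ℕ; zero; suc; _+_; _≤_; _<_; _⊔_; z≤n; s≤s)
open import Data.Nat.Properties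
  using (≤-refl; ≤-reflexive; ≤-trans; ≤-pred; ≤-antisym; <⇒≤; <⇒≢; <⇒≱; ≮⇒≥; <-cmp; n<1+n;
         n≤1+n; m≤n⇒m≤1+n; m≤n⇒m<n∨m≡n; m≤n⇒m≤n⊔o; m≤n⇒m≤o⊔n; n≢0⇒n>0; +-comm; anyUpTo?)
import Data.Nat.Properties as ℕ
open import Data.Product using (∃-syntax; _×_; _,_; proj₁; proj₂)
open import Data.Sum using (_⊎_; inj₁; inj₂; [_,_]′)
open import Data.Unit using (tt)
open import Data.Vec.Functional using (updateAt)
open import Data.Vec.Functional.Properties using (updateAt-updates; updateAt-minimal)
open import Function.Base using (_∘_; _∋_; id; const)
open import Function.Bundles using (_⇔_; mk⇔; Equivalence)
open import Function.Definitions using (Injective)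
open import Relation.Binary.Definitions using (tri<; tri≈; tri>)
open import Relation.Binary.PropositionalEquality
  using (_≡_; _≢_; refl; sym; trans; cong; subst; setoid; ≢-sym)
open import Relation.Nullary using (¬_; Dec; yes; no; contradiction)
open import Relation.Nullary.Decidable
  using (⌊_⌋; T?; ¬?; _×-dec_; _⊎-dec_; _→-dec_; toWitness; fromWitness; dec-true; dec-false; map′; toSum)
open import Relation.Unary using (Decidable)

open Equivalence using (to; from)

AtMost : ∀ {k} → ℕ → (Fin k → Set) → Set
AtMost {k} j P = ∀ {i} (f : Fin i → Fin k) → Injective _≡_ _≡_ f → (∀ t → P (f t)) → i ≤ j

atMost-length-filter : ∀ {k} (P : Fin k → Bool) → AtMost (length (filterᵇ P (allFin k))) (T ∘ P)
atMost-length-filter {k} P f f-injective Pf = injective⇒≤ position-injective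
  where
  member : ∀ t → f t ∈ filterᵇ P (allFin k)
  member t = ∈-filter⁺ (T? ∘ P) (∈-allFin (f t)) (Pf t)

  position-injective : Injective _≡_ _≡_ (λ t → index (member t))
  position-injective eq =
    f-injective (SetoidMembership.index-injective (setoid (Fin k)) (member _) (member _) eq)

≤-foldr-⊔ : ∀ {d} (xs : List ℕ) → Any (d ≤_) xs → d ≤ foldr _⊔_ 0 xs
≤-foldr-⊔ xs d≤x = foldr-preservesᵒ (λ a b → [ m≤n⇒m≤n⊔o b , m≤n⇒m≤o⊔n a ]′) 0 xs (inj₂ d≤x)

any-concatMap² : ∀ {A B : Set} {P : B → Set} (h : A → A → List B) {xs u v} →
                 u ∈ xs → v ∈ xs → Any P (h u v) →
                 Any P (concatMap (λ u → concatMap (h u) xs) xs)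
any-concatMap² h u∈xs v∈xs p = concatMap⁺ _ (lose u∈xs (concatMap⁺ _ (lose v∈xs p)))

module _ {m k} {P : Fin m → Set} (P? : Decidable P) (c : Fin m → Maybe (Fin k)) where

  private
    used? : ∀ a → Dec (∃[ e ] P e × c e ≡ just a)
    used? a = any? (λ e → P? e ×-dec ≡-dec-Maybe _≟_ (c e) (just a))

  unused-colour : ∀ {j} → AtMost j P → j < k → ∃[ a ] ∀ e → P e → c e ≢ just a
  unused-colour few j<k with all? used?
  ... | yes used = contradiction (few (proj₁ ∘ used) user-injective (proj₁ ∘ proj₂ ∘ used)) (<⇒≱ j<k)
    where
    user-injective : Injective _≡_ _≡_ (proj₁ ∘ used)
    user-injective {a} {b} same =
      just-injective (trans (sym (proj₂ (proj₂ (used a)))) (trans (cong c same) (proj₂ (proj₂ (used b)))))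
  ... | no ¬all-used with ¬∀⟶∃¬ k _ used? ¬all-used
  ...   | a , unused = a , λ e Pe ce → unused (e , Pe , ce)

module _ (G : Graph) where
  open Graph G

  -- Δ₂ lists commonNbrs u v only after testing u ≟ v; abstracting over that test in the
  -- type of the second with-expression lets the test reduce.
  commonNbrs≤Δ₂ : ∀ {u v} → u ≢ v → commonNbrs G u v ≤ Δ₂ G
  commonNbrs≤Δ₂ {u} {v} u≢v
    with u ≟ v
       | (Any (commonNbrs G u v ≤_) _ → commonNbrs G u v ≤ Δ₂ G)
           ∋ (≤-foldr-⊔ _ ∘ any-concatMap² _ (∈-allFin u) (∈-allFin v))
  ... | yes u≡v | _     = contradiction u≡v u≢v
  ... | no _    | bound = bound (here ≤-refl)

  CommonNbr : Fin k → Fin k → Fin k → Set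
  CommonNbr u v w = T (adj u w) × T (adj v w)

  atMost-commonNbr : ∀ {u v} → u ≢ v → AtMost (Δ₂ G) (CommonNbr u v)
  atMost-commonNbr {u} {v} u≢v f f-injective common =
    ≤-trans (atMost-length-filter (λ w → adj u w ∧ adj v w) f f-injective (from T-∧ ∘ common))
            (commonNbrs≤Δ₂ u≢v)

  IsClique : ∀ {j} → (Fin j → Fin k) → Set
  IsClique f = ∀ i i′ → i ≢ i′ → T (adj (f i) (f i′))

  clique⇒size≤2+Δ₂ : ∀ {j} (f : Fin j → Fin k) → Injective _≡_ _≡_ f → IsClique f → j ≤ 2 + Δ₂ G
  clique⇒size≤2+Δ₂ {zero}        _ _ _ = z≤n
  clique⇒size≤2+Δ₂ {suc zero}    _ _ _ = s≤s z≤n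
  clique⇒size≤2+Δ₂ {suc (suc j)} f f-injective clique =
    s≤s (s≤s (atMost-commonNbr f₀≢f₁ (λ i → f (suc (suc i)))
                (suc-injective ∘ suc-injective ∘ f-injective)
                (λ i → clique zero (suc (suc i)) (λ ()) , clique (suc zero) (suc (suc i)) (λ ()))))
    where
    f₀≢f₁ : f zero ≢ f (suc zero)
    f₀≢f₁ eq with f-injective eq
    ... | ()

  Dominates : Fin k → Fin k → Set
  Dominates v u = ∀ w → T (adj u w) → w ≢ v → T (adj v w)

  dominated⇒degree≤1+Δ₂ : ∀ {u v} → u ≢ v → Dominates v u → AtMost (1 + Δ₂ G) (T ∘ adj u)
  dominated⇒degree≤1+Δ₂ _ _ {zero} _ _ _ = z≤n
  dominated⇒degree≤1+Δ₂ {u} {v} u≢v dominates {suc j} f f-injective nbr with any? (λ i → f i ≟ v)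
  ... | yes (i , fi≡v) =
    s≤s (atMost-commonNbr u≢v (f ∘ punchIn i) (punchIn-injective i _ _ ∘ f-injective) common)
    where
    common : ∀ i′ → CommonNbr u v (f (punchIn i i′))
    common i′ = nbr _ , dominates _ (nbr _) (λ eq → punchInᵢ≢i i i′ (f-injective (trans eq (sym fi≡v))))
  ... | no ∄f≡v =
    m≤n⇒m≤1+n (atMost-commonNbr u≢v f f-injective
                 (λ i → nbr i , dominates _ (nbr i) (λ eq → ∄f≡v (i , eq))))

module _ {n : ℕ} where

  EndsMeet : Fin n → Fin n → Fin n → Fin n → Set
  EndsMeet a b c d = ∃[ v ] (a ≡ v ⊎ b ≡ v) × (c ≡ v ⊎ d ≡ v)

  T-endsMeet : ∀ a b c d →
               T (⌊ a ≟ c ⌋ ∨ ⌊ a ≟ d ⌋ ∨ ⌊ b ≟ c ⌋ ∨ ⌊ b ≟ d ⌋) ⇔ EndsMeet a b c d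
  T-endsMeet a b c d = mk⇔ sound (λ (_ , p , q) → complete p q)
    where
    sound : T (⌊ a ≟ c ⌋ ∨ ⌊ a ≟ d ⌋ ∨ ⌊ b ≟ c ⌋ ∨ ⌊ b ≟ d ⌋) → EndsMeet a b c d
    sound t with a ≟ c | a ≟ d | b ≟ c | b ≟ d
    ... | yes a≡c | _       | _       | _       = a , inj₁ refl , inj₁ (sym a≡c)
    ... | no _    | yes a≡d | _       | _       = a , inj₁ refl , inj₂ (sym a≡d)
    ... | no _    | no _    | yes b≡c | _       = b , inj₂ refl , inj₁ (sym b≡c)
    ... | no _    | no _    | no _    | yes b≡d = b , inj₂ refl , inj₂ (sym b≡d)
    ... | no _    | no _    | no _    | no _    = ⊥-elim t

    complete : ∀ {v} → a ≡ v ⊎ b ≡ v → c ≡ v ⊎ d ≡ v →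
               T (⌊ a ≟ c ⌋ ∨ ⌊ a ≟ d ⌋ ∨ ⌊ b ≟ c ⌋ ∨ ⌊ b ≟ d ⌋)
    complete p q with a ≟ c | a ≟ d | b ≟ c | b ≟ d
    ... | yes _ | _     | _     | _     = tt
    ... | no _  | yes _ | _     | _     = tt
    ... | no _  | no _  | yes _ | _     = tt
    ... | no _  | no _  | no _  | yes _ = tt
    ... | no a≢c | no a≢d | no b≢c | no b≢d = apart p q
      where
      apart : ∀ {v} → a ≡ v ⊎ b ≡ v → c ≡ v ⊎ d ≡ v → ⊥
      apart (inj₁ a≡v) (inj₁ c≡v) = a≢c (trans a≡v (sym c≡v))
      apart (inj₁ a≡v) (inj₂ d≡v) = a≢d (trans a≡v (sym d≡v))
      apart (inj₂ b≡v) (inj₁ c≡v) = b≢c (trans b≡v (sym c≡v))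
      apart (inj₂ b≡v) (inj₂ d≡v) = b≢d (trans b≡v (sym d≡v))

module Incidence (H : Multigraph) where
  open Multigraph H public

  end₁ end₂ : Fin m → Fin n
  end₁ e = proj₁ (ends e)
  end₂ e = proj₂ (ends e)

  Incident : Fin m → Fin n → Set
  Incident e v = end₁ e ≡ v ⊎ end₂ e ≡ v

  incident? : ∀ e v → Dec (Incident e v)
  incident? e v = end₁ e ≟ v ⊎-dec end₂ e ≟ v

  ShareEnd : Fin m → Fin m → Set
  ShareEnd e f = ∃[ v ] Incident e v × Incident f v

  Loop : Fin m → Set
  Loop e = end₁ e ≡ end₂ e

  Covers : Fin m → Fin m → Set
  Covers h e = ∀ v → Incident e v → Incident h v

  Simple : Fin m → Set
  Simple e = ¬ Loop e × (∀ h → h ≢ e → ¬ Covers h e)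

  simple? : ∀ e → Dec (Simple e)
  simple? e = ¬? (end₁ e ≟ end₂ e)
        ×-dec all? (λ h → ¬? (h ≟ e) →-dec ¬? (all? (λ v → incident? e v →-dec incident? h v)))

  T-shareEnd : ∀ e f → T (shareEnd H e f) ⇔ ShareEnd e f
  T-shareEnd e f with ends e | ends f
  ... | a , b | c , d = T-endsMeet a b c d

  T-adj : ∀ e f → T (Graph.adj (lineGraph H) e f) ⇔ (e ≢ f × ShareEnd e f)
  T-adj e f with e ≟ f
  ... | yes e≡f = mk⇔ (λ ()) (λ (e≢f , _) → e≢f e≡f)
  ... | no e≢f  = mk⇔ (λ t → e≢f , to (T-shareEnd e f) t) (from (T-shareEnd e f) ∘ proj₂)

  otherEnd : Fin m → Fin n → Fin n
  otherEnd e v with end₁ e ≟ v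
  ... | yes _ = end₂ e
  ... | no _  = end₁ e

  otherEnd-incident : ∀ e v → Incident e (otherEnd e v)
  otherEnd-incident e v with end₁ e ≟ v
  ... | yes _ = inj₂ refl
  ... | no _  = inj₁ refl

  incident⇒≡∨otherEnd : ∀ {e u v} → Incident e v → Incident e u → u ≡ v ⊎ u ≡ otherEnd e v
  incident⇒≡∨otherEnd {e} {u} {v} ev eu with end₁ e ≟ v | ev | eu
  ... | yes e₁≡v | _ | inj₁ e₁≡u = inj₁ (trans (sym e₁≡u) e₁≡v)
  ... | yes _    | _ | inj₂ e₂≡u = inj₂ (sym e₂≡u)
  ... | no _     | _ | inj₁ e₁≡u = inj₂ (sym e₁≡u)
  ... | no e₁≢v  | inj₁ e₁≡v | inj₂ _ = contradiction e₁≡v e₁≢v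
  ... | no _     | inj₂ e₂≡v | inj₂ e₂≡u = inj₁ (trans (sym e₂≡u) e₂≡v)

  ≡otherEnd : ∀ {e u v} → Incident e v → Incident e u → u ≢ v → u ≡ otherEnd e v
  ≡otherEnd ev eu u≢v with incident⇒≡∨otherEnd ev eu
  ... | inj₁ u≡v = contradiction u≡v u≢v
  ... | inj₂ u≡w = u≡w

  otherEnd≢ : ∀ {e v} → Incident e v → ¬ Loop e → otherEnd e v ≢ v
  otherEnd≢ {e} {v} ev ¬loop with end₁ e ≟ v
  ... | yes e₁≡v = λ e₂≡v → ¬loop (trans e₁≡v (sym e₂≡v))
  ... | no e₁≢v  = e₁≢v

module PartialColouring (H : Multigraph) (k : ℕ) where
  open Incidence H public

  Colouring : Set
  Colouring = Fin m → Maybe (Fin k)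

  Proper : Colouring → Set
  Proper c = ∀ e f {v a} → e ≢ f → Incident e v → Incident f v → c e ≡ just a → c f ≢ just a

  Missing : Colouring → Fin n → Fin k → Set
  Missing c v a = ∀ e → Incident e v → c e ≢ just a

  Coloured : Colouring → Fin m → Set
  Coloured c e = is-just (c e) ≡ true

  _[_≔_] : Colouring → Fin m → Maybe (Fin k) → Colouring
  c [ e ≔ x ] = updateAt c e (const x)

  ≔-updates : ∀ c e {x} → (c [ e ≔ x ]) e ≡ x
  ≔-updates c e = updateAt-updates e c

  ≔-minimal : ∀ c {e x g} → g ≢ e → (c [ e ≔ x ]) g ≡ c g
  ≔-minimal c {e} {g = g} = updateAt-minimal g e c

  colour-proper : ∀ {c e a} → Proper c → (∀ v → Incident e v → Missing c v a) →
                  Proper (c [ e ≔ just a ])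
  colour-proper {c} {e} proper missing g h g≢h gv hv cg ch with g ≟ e | h ≟ e
  ... | yes refl | yes refl = g≢h refl
  ... | yes refl | no h≢e   with just-injective (trans (sym (≔-updates c e)) cg)
  ...   | refl = missing _ gv h hv (trans (sym (≔-minimal c h≢e)) ch)
  colour-proper {c} {e} proper missing g h g≢h gv hv cg ch | no g≢e | yes refl
    with just-injective (trans (sym (≔-updates c e)) ch)
  ... | refl = missing _ hv g gv (trans (sym (≔-minimal c g≢e)) cg)
  colour-proper {c} {e} proper missing g h g≢h gv hv cg ch | no g≢e | no h≢e =
    proper g h g≢h gv hv (trans (sym (≔-minimal c g≢e)) cg)
                         (trans (sym (≔-minimal c h≢e)) ch)

  record Extends (c d : Colouring) (e : Fin m) : Set where
    field
      proper  : Proper d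
      colours : Coloured d e
      agrees  : ∀ g → g ≢ e → is-just (d g) ≡ is-just (c g)

  extends-keeps : ∀ {c d e g} → Extends c d e → Coloured c g → Coloured d g
  extends-keeps {e = e} {g} ext cg with g ≟ e
  ... | yes refl = Extends.colours ext
  ... | no g≢e   = trans (Extends.agrees ext g g≢e) cg

  extends-only : ∀ {c d e g} → Extends c d e → Coloured d g → Coloured c g ⊎ g ≡ e
  extends-only {e = e} {g} ext dg with g ≟ e
  ... | yes g≡e = inj₂ g≡e
  ... | no g≢e  = inj₁ (trans (sym (Extends.agrees ext g g≢e)) dg)

  colour-all : (Inv : Colouring → Set) {P : Fin m → Set} → Decidable P →
               (∀ {c e} → Inv c → P e → c e ≡ nothing → ∃[ d ] Inv d × Extends c d e) →
               ∀ {c} → Inv c → ∃[ d ] Inv d × (∀ e → P e → Coloured d e)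
  colour-all Inv {P} P? extend {c} inv =
    let d , inv-d , done = colour-list (allFin m) in d , inv-d , λ e → done (∈-allFin e)
    where
    colour-list : ∀ es → ∃[ d ] Inv d × (∀ {e} → e ∈ es → P e → Coloured d e)
    colour-list [] = c , inv , λ ()
    colour-list (e ∷ es) with colour-list es
    ... | d , inv-d , done with P? e | d e in de
    ...   | no ¬Pe | _      = d , inv-d , λ { (here refl) Pe → contradiction Pe ¬Pe ; (there g∈) → done g∈ }
    ...   | yes _  | just _ = d , inv-d , λ { (here refl) _ → cong is-just de ; (there g∈) → done g∈ }
    ...   | yes Pe | nothing with extend inv-d Pe de
    ...     | d′ , inv-d′ , ext = d′ , inv-d′ , λ { (here refl) _ → Extends.colours ext
                                                  ; (there g∈) Pg → extends-keeps ext (done g∈ Pg) }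

  total⇒colourable : ∀ {c} → Proper c → (∀ e → Coloured c e) → Colourable (lineGraph H) k
  total⇒colourable {c} proper coloured = colour , proper-colour
    where
    coloured⇒just : ∀ e → ∃[ a ] c e ≡ just a
    coloured⇒just e with c e | coloured e
    ... | just a | _ = a , refl

    colour : Fin m → Fin k
    colour e = proj₁ (coloured⇒just e)

    proper-colour : ProperColouring (lineGraph H) k colour
    proper-colour e f e~f same with to (T-adj e f) e~f
    ... | e≢f , v , e-v , f-v = proper e f e≢f e-v f-v (proj₂ (coloured⇒just e))
                                  (trans (proj₂ (coloured⇒just f)) (cong just (sym same)))

  edgeAt : Colouring → Fin n → Fin k → Maybe (Fin m)
  edgeAt c v a with any? (λ e → incident? e v ×-dec ≡-dec-Maybe _≟_ (c e) (just a))
  ... | yes (e , _) = just e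
  ... | no _        = nothing

  edgeAt-just : ∀ {c v a e} → edgeAt c v a ≡ just e → Incident e v × c e ≡ just a
  edgeAt-just {c} {v} {a} eq with any? (λ e → incident? e v ×-dec ≡-dec-Maybe _≟_ (c e) (just a))
  edgeAt-just refl | yes (_ , found) = found

  edgeAt-nothing : ∀ {c v a} → edgeAt c v a ≡ nothing → Missing c v a
  edgeAt-nothing {c} {v} {a} eq e ev ce with any? (λ e → incident? e v ×-dec ≡-dec-Maybe _≟_ (c e) (just a))
  edgeAt-nothing refl e ev ce | no none = none (e , ev , ce)

  edgeAt-unique : ∀ {c v a e} → Proper c → Incident e v → c e ≡ just a → edgeAt c v a ≡ just e
  edgeAt-unique {c} {v} {a} {e} proper ev ce with edgeAt c v a in found
  ... | nothing = contradiction ce (edgeAt-nothing found e ev)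
  ... | just e′ with e′ ≟ e
  ...   | yes e′≡e = cong just e′≡e
  ...   | no e′≢e  =
    contradiction ce (proper e′ e e′≢e (proj₁ (edgeAt-just found)) ev (proj₂ (edgeAt-just found)))

  module Kempe (α β : Fin k) where

    InPair : Fin k → Set
    InPair a = a ≡ α ⊎ a ≡ β

    inPair? : ∀ a → Dec (InPair a)
    inPair? a = a ≟ α ⊎-dec a ≟ β

    swap : Fin k → Fin k
    swap = transpose α β

    swap-α : swap α ≡ β
    swap-α rewrite dec-true (α ≟ α) refl = refl

    swap-β : swap β ≡ α
    swap-β with β ≟ α
    ... | yes β≡α = β≡α
    ... | no _ rewrite dec-true (β ≟ β) refl = refl

    swap-other : ∀ {a} → ¬ InPair a → swap a ≡ a
    swap-other {a} ∉pair
      rewrite dec-false (a ≟ α) (∉pair ∘ inj₁) | dec-false (a ≟ β) (∉pair ∘ inj₂) = refl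

    swap-involutive : ∀ a → swap (swap a) ≡ a
    swap-involutive a with inPair? a
    ... | yes (inj₁ refl) = trans (cong swap swap-α) swap-β
    ... | yes (inj₂ refl) = trans (cong swap swap-β) swap-α
    ... | no ∉pair        = trans (cong swap (swap-other ∉pair)) (swap-other ∉pair)

    swap-injective : ∀ {a b} → swap a ≡ swap b → a ≡ b
    swap-injective {a} {b} eq = trans (sym (swap-involutive a)) (trans (cong swap eq) (swap-involutive b))

    swap≡α : ∀ {a} → swap a ≡ α → a ≡ β
    swap≡α {a} eq = trans (sym (swap-involutive a)) (trans (cong swap eq) swap-α)

    swap-inPair : ∀ {a} → InPair a → InPair (swap a)
    swap-inPair (inj₁ refl) = inj₂ swap-α
    swap-inPair (inj₂ refl) = inj₁ swap-β

    Closed : Colouring → (Fin n → Bool) → Set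
    Closed c S = ∀ e {a u v} → c e ≡ just a → InPair a → Incident e u → Incident e v → T (S u) → T (S v)

    closed-complement : ∀ {c S} → Closed c S → Closed c (not ∘ S)
    closed-complement {S = S} closed e {v = v} ce pair eu ev u∉S with S v in Sv
    ... | false = tt
    ... | true  = subst T (to T-not-≡ u∉S) (closed e ce pair ev eu (subst T (sym Sv) tt))

    swapIf : Bool → Fin k → Fin k
    swapIf true  = swap
    swapIf false = id

    -- An edge lies on the side of S of its first end; for the α/β-edges of a closed S both ends
    -- lie on the same side.
    kempeSwap : Colouring → (Fin n → Bool) → Colouring
    kempeSwap c S e = Maybe.map (swapIf (S (end₁ e))) (c e)

    module _ {c : Colouring} {S : Fin n → Bool} where

      kempeSwap-coloured : ∀ e → is-just (kempeSwap c S e) ≡ is-just (c e)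
      kempeSwap-coloured e with c e
      ... | just _  = refl
      ... | nothing = refl

      kempeSwap-just : ∀ e {b} → kempeSwap c S e ≡ just b → ∃[ a ] c e ≡ just a × swapIf (S (end₁ e)) a ≡ b
      kempeSwap-just e eq with c e
      kempeSwap-just e refl | just a = a , refl , refl

      module _ (closed : Closed c S) where

        private
          swap-across-S : Proper c → ∀ e f {v a₁ a₂} → e ≢ f → Incident e v → Incident f v →
                          c e ≡ just a₁ → c f ≡ just a₂ → S (end₁ e) ≡ true → S (end₁ f) ≡ false →
                          swap a₁ ≢ a₂
          swap-across-S proper e f {a₁ = a₁} e≢f ev fv ce cf Se Sf swapped with inPair? a₁
          ... | yes pair =
            subst T Sf (closed f cf (subst InPair swapped (swap-inPair pair)) fv (inj₁ refl)
                          (closed e ce pair (inj₁ refl) ev (subst T (sym Se) tt)))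
          ... | no ∉pair =
            proper e f e≢f ev fv ce (subst (λ a → c f ≡ just a) (trans (sym swapped) (swap-other ∉pair)) cf)

        kempeSwap-proper : Proper c → Proper (kempeSwap c S)
        kempeSwap-proper proper e f e≢f ev fv se sf
          with kempeSwap-just e se | kempeSwap-just f sf
        ... | a₁ , ce , sa₁ | a₂ , cf , sa₂ with S (end₁ e) in Se | S (end₁ f) in Sf
        ... | true  | true  =
          proper e f e≢f ev fv ce (subst (λ a → c f ≡ just a) (swap-injective (trans sa₂ (sym sa₁))) cf)
        ... | false | false = proper e f e≢f ev fv ce (subst (λ a → c f ≡ just a) (trans sa₂ (sym sa₁)) cf)
        ... | true  | false = swap-across-S proper e f e≢f ev fv ce cf Se Sf (trans sa₁ (sym sa₂))
        ... | false | true  = swap-across-S proper f e (≢-sym e≢f) fv ev cf ce Sf Se (trans sa₂ (sym sa₁))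

        kempeSwap-missing-outside : ∀ {v} → ¬ T (S v) → Missing c v α → Missing (kempeSwap c S) v α
        kempeSwap-missing-outside v∉S missing e ev se with kempeSwap-just e se
        ... | a , ce , sa with S (end₁ e) in Se
        ... | true  = v∉S (closed e ce (inj₂ (swap≡α sa)) (inj₁ refl) ev (subst T (sym Se) tt))
        ... | false = missing e ev (trans ce (cong just sa))

        kempeSwap-missing-inside : ∀ {v} → T (S v) → Missing c v β → Missing (kempeSwap c S) v α
        kempeSwap-missing-inside v∈S missing e ev se with kempeSwap-just e se
        ... | a , ce , sa with S (end₁ e) in Se
        ... | true  = missing e ev (trans ce (cong just (swap≡α sa)))
        ... | false = subst T Se (closed e ce (inj₁ sa) ev (inj₁ refl) v∈S)

module KempeChains (H : Multigraph) (k : ℕ) where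
  open PartialColouring H k

  Loopless : Colouring → Set
  Loopless c = ∀ e {a} → c e ≡ just a → ¬ Loop e

  MissesOneOf : Colouring → Fin k → Fin k → Fin n → Set
  MissesOneOf c α β v = Missing c v α ⊎ Missing c v β

  record KempeChain (c : Colouring) (α β : Fin k) (x : Fin n) : Set where
    open Kempe α β
    field
      member     : Fin n → Bool
      contains-x : T (member x)
      closed     : Closed c member
      one-end    : ∀ {u v} → T (member u) → T (member v) → u ≢ x → v ≢ x →
                   MissesOneOf c α β u → MissesOneOf c α β v → u ≡ v

  module Walk {c : Colouring} (proper : Proper c) (loopless : Loopless c)
              {α β : Fin k} (α≢β : α ≢ β) {x : Fin n} (x-missing : Missing c x α) where
    open Kempe α β

    record Step (a : Fin k) (u w : Fin n) : Set where
      field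
        edge   : Fin m
        colour : c edge ≡ just a
        at-u   : Incident edge u
        at-w   : Incident edge w
        w≢u    : w ≢ u

    reverse : ∀ {a u w} → Step a u w → Step a w u
    reverse s = record { edge = edge ; colour = colour ; at-u = at-w ; at-w = at-u ; w≢u = ≢-sym w≢u }
      where open Step s

    step-unique : ∀ {a u w w′} → Step a u w → Step a u w′ → w ≡ w′
    step-unique s s′ with Step.edge s ≟ Step.edge s′
    ... | no e≢e′ = contradiction (Step.colour s′) (proper _ _ e≢e′ (Step.at-u s) (Step.at-u s′) (Step.colour s))
    ... | yes refl = trans (≡otherEnd (Step.at-u s) (Step.at-w s) (Step.w≢u s))
                           (sym (≡otherEnd (Step.at-u s) (Step.at-w s′) (Step.w≢u s′)))

    γ : ℕ → Fin k
    γ zero          = β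
    γ (suc zero)    = α
    γ (suc (suc i)) = γ i

    γ-alternates : ∀ i → γ (suc i) ≢ γ i
    γ-alternates zero          = α≢β
    γ-alternates (suc zero)    = ≢-sym α≢β
    γ-alternates (suc (suc i)) = γ-alternates i

    γ-inPair : ∀ i → InPair (γ i)
    γ-inPair zero          = inj₂ refl
    γ-inPair (suc zero)    = inj₁ refl
    γ-inPair (suc (suc i)) = γ-inPair i

    inPair⇒γ : ∀ i {a} → InPair a → a ≡ γ i ⊎ a ≡ γ (suc i)
    inPair⇒γ zero          (inj₁ a≡α) = inj₂ a≡α
    inPair⇒γ zero          (inj₂ a≡β) = inj₁ a≡β
    inPair⇒γ (suc zero)    (inj₁ a≡α) = inj₁ a≡α
    inPair⇒γ (suc zero)    (inj₂ a≡β) = inj₂ a≡β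
    inPair⇒γ (suc (suc i)) p          = inPair⇒γ i p

    position : ℕ → Maybe (Fin n)
    position zero    = just x
    position (suc i) = position i >>= λ u → Maybe.map (λ e → otherEnd e u) (edgeAt c u (γ i))

    position-suc : ∀ {i w} → position (suc i) ≡ just w → ∃[ u ] position i ≡ just u × Step (γ i) u w
    position-suc {i} eq with position i
    ... | just u with edgeAt c u (γ i) in found
    position-suc refl | just u | just e = u , refl , record
      { edge = e ; colour = proj₂ (edgeAt-just found) ; at-u = proj₁ (edgeAt-just found)
      ; at-w = otherEnd-incident e u
      ; w≢u = otherEnd≢ (proj₁ (edgeAt-just found)) (loopless e (proj₂ (edgeAt-just found))) }

    position-step : ∀ {i u w} → position i ≡ just u → Step (γ i) u w → position (suc i) ≡ just w
    position-step {i} {u} pos s rewrite pos | edgeAt-unique proper (Step.at-u s) (Step.colour s) =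
      cong just (sym (≡otherEnd (Step.at-u s) (Step.at-w s) (Step.w≢u s)))

    position-stop : ∀ {i u} → position i ≡ just u → Missing c u (γ i) → position (suc i) ≡ nothing
    position-stop {i} {u} pos missing rewrite pos with edgeAt c u (γ i) in found
    ... | nothing = refl
    ... | just e  = contradiction (proj₂ (edgeAt-just found)) (missing e (proj₁ (edgeAt-just found)))

    position-down : ∀ {i j w} → i ≤ j → position j ≡ just w → ∃[ u ] position i ≡ just u
    position-down {j = zero}  z≤n   pos = _ , pos
    position-down {j = suc j} i≤1+j pos with m≤n⇒m<n∨m≡n i≤1+j
    ... | inj₂ refl  = _ , pos
    ... | inj₁ i<1+j = position-down (≤-pred i<1+j) (proj₁ (proj₂ (position-suc {j} pos)))

    beyond-end : ∀ {i j w} → position i ≡ nothing → i ≤ j → position j ≡ just w → ⊥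
    beyond-end stop i≤j pos with position-down i≤j pos
    ... | _ , pos-i with trans (sym stop) pos-i
    ...   | ()

    -- A second visit to u would arrive along one of the two α/β-edges at u already used,
    -- forcing an earlier repetition.
    no-revisit : ∀ j {i u} → i < j → position i ≡ just u → position j ≡ just u → ⊥
    no-revisit (suc j) {i} {u} i<j pos-i pos-j with position-suc {j} pos-j
    ... | v , pos-v , last = revisit i i<j pos-i
      where
      revisit : ∀ i → i < suc j → position i ≡ just u → ⊥
      revisit zero _ pos-0 with just-injective pos-0 | γ-inPair j
      ... | refl | inj₁ γj≡α = x-missing _ (Step.at-w last) (trans (Step.colour last) (cong just γj≡α))
      ... | refl | inj₂ γj≡β = from-x j γj≡β pos-v
        where
        pos-1 : position 1 ≡ just v
        pos-1 = position-step {0} refl (subst (λ a → Step a x v) γj≡β (reverse last))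

        from-x : ∀ j → γ j ≡ β → position j ≡ just v → ⊥
        from-x zero          _   pos-0′ = Step.w≢u last (just-injective pos-0′)
        from-x (suc zero)    α≡β _      = α≢β α≡β
        from-x (suc (suc j)) _   pos-j′ = no-revisit (suc (suc j)) (s≤s (s≤s z≤n)) pos-1 pos-j′
      revisit (suc i) si<sj pos-si with position-suc {i} pos-si | inPair⇒γ i (γ-inPair j)
      ... | w , pos-w , arrive | inj₁ γj≡γi =
        no-revisit j (≤-pred si<sj) pos-w
          (trans pos-v (cong just (step-unique (reverse last) (subst (λ a → Step a u w) (sym γj≡γi) (reverse arrive)))))
      ... | w , pos-w , arrive | inj₂ γj≡γsi with <-cmp (suc (suc i)) j
      ...   | tri< ssi<j _ _ = no-revisit j ssi<j pos-ssi pos-v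
        where
        pos-ssi : position (suc (suc i)) ≡ just v
        pos-ssi = position-step {suc i} pos-si (subst (λ a → Step a u v) γj≡γsi (reverse last))
      ...   | tri≈ _ refl _ = γ-alternates (suc i) γj≡γsi
      ...   | tri> _ _ j<ssi with ≤-antisym (≤-pred si<sj) (≤-pred j<ssi)
      ...     | refl = Step.w≢u last (just-injective (trans (sym pos-si) pos-v))

    walk-ends : position n ≡ nothing
    walk-ends with position n in pos-n
    ... | nothing = refl
    ... | just _ with pigeonhole (n<1+n n) (λ t → proj₁ (position-down (toℕ≤pred[n] t) pos-n))
    ...   | s , t , s<t , same =
      ⊥-elim (no-revisit (toℕ t) s<t (proj₂ (position-down (toℕ≤pred[n] s) pos-n))
                         (trans (proj₂ (position-down (toℕ≤pred[n] t) pos-n)) (cong just (sym same))))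

    position⇒<n : ∀ {i u} → position i ≡ just u → i < n
    position⇒<n {i} pos with i ℕ.<? n
    ... | yes i<n = i<n
    ... | no i≮n  = ⊥-elim (beyond-end walk-ends (≮⇒≥ i≮n) pos)

    member : Fin n → Bool
    member u = ⌊ any? (λ (t : Fin n) → ≡-dec-Maybe _≟_ (position (toℕ t)) (just u)) ⌋

    member-intro : ∀ i {u} → position i ≡ just u → T (member u)
    member-intro i {u} pos =
      fromWitness (fromℕ< i<n , subst (λ j → position j ≡ just u) (sym (toℕ-fromℕ< i<n)) pos)
      where
      i<n : i < n
      i<n = position⇒<n pos

    member-elim : ∀ {u} → T (member u) → ∃[ i ] position i ≡ just u
    member-elim u∈ with toWitness u∈
    ... | t , pos = toℕ t , pos

    step-from-walk : ∀ i {a u v} → position i ≡ just u → Step a u v → InPair a → ∃[ j ] position j ≡ just v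
    step-from-walk zero pos s (inj₁ refl) with just-injective pos
    ... | refl = contradiction (Step.colour s) (x-missing _ (Step.at-u s))
    step-from-walk zero pos s (inj₂ refl) = 1 , position-step {0} pos s
    step-from-walk (suc i) pos s pair with inPair⇒γ i pair
    ... | inj₂ refl = suc (suc i) , position-step {suc i} pos s
    ... | inj₁ refl with position-suc {i} pos
    ...   | w , pos-w , arrive = i , trans pos-w (cong just (step-unique (reverse arrive) s))

    member-closed : Closed c member
    member-closed e {u = u} {v} ce pair eu ev u∈ with v ≟ u
    ... | yes refl = u∈
    ... | no v≢u with member-elim u∈
    ...   | i , pos = let j , pos-v = step-from-walk i pos s pair in member-intro j pos-v
      where
      s : Step _ u v
      s = record { edge = e ; colour = ce ; at-u = eu ; at-w = ev ; w≢u = v≢u }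

    walk-stops-at : ∀ {u} → T (member u) → u ≢ x → MissesOneOf c α β u →
                    ∃[ i ] position i ≡ just u × position (suc i) ≡ nothing
    walk-stops-at {u} u∈ u≢x misses with member-elim u∈
    ... | zero , pos = contradiction (sym (just-injective pos)) u≢x
    ... | suc i , pos with position-suc {i} pos
    ...   | _ , _ , arrive = suc i , pos , position-stop {suc i} pos (missing-next misses)
      where
      present : ∀ {a} → Missing c u a → a ≢ γ i
      present missing refl = missing _ (Step.at-w arrive) (Step.colour arrive)

      missing-next : MissesOneOf c α β u → Missing c u (γ (suc i))
      missing-next (inj₁ missing) with inPair⇒γ i (inj₁ refl)
      ... | inj₁ α≡γi  = contradiction α≡γi (present missing)
      ... | inj₂ α≡γsi = subst (Missing c u) α≡γsi missing
      missing-next (inj₂ missing) with inPair⇒γ i (inj₂ refl)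
      ... | inj₁ β≡γi  = contradiction β≡γi (present missing)
      ... | inj₂ β≡γsi = subst (Missing c u) β≡γsi missing

    member-one-end : ∀ {u v} → T (member u) → T (member v) → u ≢ x → v ≢ x →
                     MissesOneOf c α β u → MissesOneOf c α β v → u ≡ v
    member-one-end u∈ v∈ u≢x v≢x mu mv
      with walk-stops-at u∈ u≢x mu | walk-stops-at v∈ v≢x mv
    ... | i , pos-i , stop-i | j , pos-j , stop-j with <-cmp i j
    ...   | tri≈ _ refl _ = just-injective (trans (sym pos-i) pos-j)
    ...   | tri< i<j _ _  = ⊥-elim (beyond-end stop-i i<j pos-j)
    ...   | tri> _ _ j<i  = ⊥-elim (beyond-end stop-j j<i pos-i)

  kempeChain : ∀ {c} → Proper c → Loopless c → ∀ {α β} → α ≢ β → ∀ {x} → Missing c x α →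
               KempeChain c α β x
  kempeChain proper loopless α≢β x-missing = record
    { member     = member
    ; contains-x = member-intro 0 refl
    ; closed     = member-closed
    ; one-end    = member-one-end
    }
    where open Walk proper loopless α≢β x-missing

module Vizing (H : Multigraph) (k : ℕ) where
  open PartialColouring H k
  open KempeChains H k

  module Fan {c : Colouring} (proper : Proper c) (missing : ∀ v → ∃[ a ] Missing c v a)
             (coloured⇒simple : ∀ g → Coloured c g → Simple g)
             {e₀ : Fin m} (e₀-uncoloured : c e₀ ≡ nothing) (e₀-simple : Simple e₀) where

    x : Fin n
    x = end₁ e₀

    y : Fin m → Fin n
    y e = otherEnd e x

    free : Fin n → Fin k
    free v = proj₁ (missing v)

    free-missing : ∀ v → Missing c v (free v)
    free-missing v = proj₂ (missing v)

    next : Fin m → Maybe (Fin m)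
    next e = edgeAt c x (free (y e))

    -- e₀ is a junk value once next fails; IsFan i certifies the first i steps.
    F : ℕ → Fin m
    F zero    = e₀
    F (suc t) = fromMaybe e₀ (next (F t))

    InFan : ℕ → Fin m → Set
    InFan l g = ∃[ t ] t ≤ l × F t ≡ g

    inFan? : ∀ l g → Dec (InFan l g)
    inFan? l g = map′ (λ (t , t<1+l , Ft≡g) → t , ≤-pred t<1+l , Ft≡g)
                      (λ (t , t≤l , Ft≡g) → t , s≤s t≤l , Ft≡g)
                      (anyUpTo? (λ t → F t ≟ g) (suc l))

    record IsFan (i : ℕ) : Set where
      field
        next-F    : ∀ {t} → t < i → next (F t) ≡ just (F (suc t))
        injective : ∀ {s t} → s ≤ i → t ≤ i → F s ≡ F t → s ≡ t

    rotate : ℕ → Colouring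
    rotate l g with anyUpTo? (λ t → F t ≟ g) l
    ... | yes (t , _ , _) = c (F (suc t))
    ... | no _ with g ≟ F l
    ...   | yes _ = nothing
    ...   | no _  = c g

    module _ {i : ℕ} (fan : IsFan i) where
      open IsFan fan

      F-incident : ∀ {t} → t ≤ i → Incident (F t) x
      F-incident {zero}  _     = inj₁ refl
      F-incident {suc t} t<i = proj₁ (edgeAt-just (next-F t<i))

      F-colour : ∀ {t} → t < i → c (F (suc t)) ≡ just (free (y (F t)))
      F-colour t<i = proj₂ (edgeAt-just (next-F t<i))

      F-coloured : ∀ {t} → t ≤ i → F t ≢ e₀ → Coloured c (F t)
      F-coloured {zero}  _   Ft≢e₀ = contradiction refl Ft≢e₀
      F-coloured {suc t} t<i _     = cong is-just (F-colour t<i)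

      F-simple : ∀ {t} → t ≤ i → Simple (F t)
      F-simple {zero}  _   = e₀-simple
      F-simple {suc t} t<i = coloured⇒simple _ (cong is-just (F-colour t<i))

      y≢x : ∀ {t} → t ≤ i → y (F t) ≢ x
      y≢x t≤i = otherEnd≢ (F-incident t≤i) (proj₁ (F-simple t≤i))

      -- two fan edges with a common far end would cover one another
      y-injective : ∀ {s t} → s ≤ i → t ≤ i → y (F s) ≡ y (F t) → s ≡ t
      y-injective {s} {t} s≤i t≤i same with F t ≟ F s
      ... | yes Ft≡Fs = injective s≤i t≤i (sym Ft≡Fs)
      ... | no Ft≢Fs  = contradiction covers (proj₂ (F-simple s≤i) (F t) Ft≢Fs)
        where
        covers : Covers (F t) (F s)
        covers v Fs-v with incident⇒≡∨otherEnd (F-incident s≤i) Fs-v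
        ... | inj₁ refl = F-incident t≤i
        ... | inj₂ refl = subst (Incident (F t)) (sym same) (otherEnd-incident (F t) x)

      incident-y : ∀ {s t} → s ≤ i → t ≤ i → Incident (F s) (y (F t)) → s ≡ t
      incident-y s≤i t≤i Fs-yt with incident⇒≡∨otherEnd (F-incident s≤i) Fs-yt
      ... | inj₁ yt≡x  = contradiction yt≡x (y≢x t≤i)
      ... | inj₂ yt≡ys = y-injective s≤i t≤i (sym yt≡ys)

      module _ {l : ℕ} (l≤i : l ≤ i) where

        private
          <l⇒<i : ∀ {t} → t < l → t < i
          <l⇒<i t<l = ≤-trans t<l l≤i

          ≤l⇒≤i : ∀ {t} → t ≤ l → t ≤ i
          ≤l⇒≤i t≤l = ≤-trans t≤l l≤i

        rotate-fan : ∀ {t} → t < l → rotate l (F t) ≡ c (F (suc t))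
        rotate-fan {t} t<l with anyUpTo? (λ s → F s ≟ F t) l
        ... | yes (s , s<l , Fs≡Ft) =
          cong (c ∘ F ∘ suc) (injective (≤l⇒≤i (<⇒≤ s<l)) (≤l⇒≤i (<⇒≤ t<l)) Fs≡Ft)
        ... | no ∉fan = contradiction (t , t<l , refl) ∉fan

        rotate-last : rotate l (F l) ≡ nothing
        rotate-last with anyUpTo? (λ s → F s ≟ F l) l
        ... | yes (s , s<l , Fs≡Fl) = contradiction (injective (≤l⇒≤i (<⇒≤ s<l)) l≤i Fs≡Fl) (<⇒≢ s<l)
        ... | no _ with F l ≟ F l
        ...   | yes _    = refl
        ...   | no Fl≢Fl = contradiction refl Fl≢Fl

        rotate-other : ∀ {g} → ¬ InFan l g → rotate l g ≡ c g
        rotate-other {g} ∉fan with anyUpTo? (λ s → F s ≟ g) l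
        ... | yes (s , s<l , Fs≡g) = contradiction (s , <⇒≤ s<l , Fs≡g) ∉fan
        ... | no _ with g ≟ F l
        ...   | yes g≡Fl = contradiction (l , ≤-refl , sym g≡Fl) ∉fan
        ...   | no _     = refl

        rotate-just : ∀ {g a} → rotate l g ≡ just a →
                      (∃[ t ] t < l × F t ≡ g × c (F (suc t)) ≡ just a) ⊎ (¬ InFan l g × c g ≡ just a)
        rotate-just {g} rg with inFan? l g
        ... | no ∉fan = inj₂ (∉fan , trans (sym (rotate-other ∉fan)) rg)
        ... | yes (t , t≤l , refl) with m≤n⇒m<n∨m≡n t≤l
        ...   | inj₁ t<l  = inj₁ (t , t<l , refl , trans (sym (rotate-fan t<l)) rg)
        ...   | inj₂ refl = contradiction (trans (sym rotate-last) rg) λ ()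

        private
          fan-vs-other : ∀ {s h v a} → s < l → ¬ InFan l h → Incident (F s) v → Incident h v →
                         c (F (suc s)) ≡ just a → c h ≢ just a
          fan-vs-other s<l ∉fan Fs-v h-v cF ch with incident⇒≡∨otherEnd (F-incident (≤l⇒≤i (<⇒≤ s<l))) Fs-v
          ... | inj₁ refl = proper _ _ (λ eq → ∉fan (_ , s<l , eq)) (F-incident (<l⇒<i s<l)) h-v cF ch
          ... | inj₂ refl = free-missing _ _ h-v (trans ch (trans (sym cF) (F-colour (<l⇒<i s<l))))

        rotate-proper : Proper (rotate l)
        rotate-proper g h g≢h g-v h-v rg rh with rotate-just rg | rotate-just rh
        ... | inj₁ (s , s<l , refl , cs) | inj₁ (t , t<l , refl , ct) =
          proper (F (suc s)) (F (suc t)) (g≢h ∘ cong F ∘ ℕ.suc-injective ∘ injective (<l⇒<i s<l) (<l⇒<i t<l))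
                 (F-incident (<l⇒<i s<l)) (F-incident (<l⇒<i t<l)) cs ct
        ... | inj₁ (s , s<l , refl , cs) | inj₂ (∉fan , ch) = fan-vs-other s<l ∉fan g-v h-v cs ch
        ... | inj₂ (∉fan , cg) | inj₁ (t , t<l , refl , ct) = fan-vs-other t<l ∉fan h-v g-v ct cg
        ... | inj₂ (_ , cg)    | inj₂ (_ , ch)               = proper g h g≢h g-v h-v cg ch

        rotate-loopless : Loopless (rotate l)
        rotate-loopless g rg with rotate-just rg
        ... | inj₁ (t , t<l , refl , _) = proj₁ (F-simple (≤l⇒≤i (<⇒≤ t<l)))
        ... | inj₂ (_ , cg)              = proj₁ (coloured⇒simple g (cong is-just cg))

        rotate-missing : ∀ {v a} → Missing c v a →
                         (∀ {t} → t < l → Incident (F t) v → c (F (suc t)) ≢ just a) → Missing (rotate l) v a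
        rotate-missing miss fan-ok g g-v rg with rotate-just rg
        ... | inj₁ (t , t<l , refl , cF) = fan-ok t<l g-v cF
        ... | inj₂ (_ , cg)              = miss g g-v cg

        rotate-missing-x : ∀ {a} → Missing c x a → Missing (rotate l) x a
        rotate-missing-x miss = rotate-missing miss (λ t<l _ → miss _ (F-incident (<l⇒<i t<l)))

        rotate-missing-y : ∀ {j b} → l ≤ j → j ≤ i → Missing c (y (F j)) b → Missing (rotate l) (y (F j)) b
        rotate-missing-y l≤j j≤i miss =
          rotate-missing miss λ t<l Ft-yj _ →
            <⇒≢ (≤-trans t<l l≤j) (incident-y (≤l⇒≤i (<⇒≤ t<l)) j≤i Ft-yj)

        rotate-coloured : ∀ {g} → g ≢ e₀ → g ≢ F l → is-just (rotate l g) ≡ is-just (c g)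
        rotate-coloured {g} g≢e₀ g≢Fl with inFan? l g
        ... | no ∉fan = cong is-just (rotate-other ∉fan)
        ... | yes (zero , _ , refl) = contradiction refl g≢e₀
        ... | yes (suc t , t<l , refl) with m≤n⇒m<n∨m≡n t<l
        ...   | inj₂ refl = contradiction refl g≢Fl
        ...   | inj₁ 1+t<l =
          trans (cong is-just (trans (rotate-fan 1+t<l) (F-colour (<l⇒<i 1+t<l))))
                (sym (F-coloured (≤l⇒≤i t<l) g≢e₀))

        rotate-colours-e₀ : 0 < l → Coloured (rotate l) e₀
        rotate-colours-e₀ 0<l = cong is-just (trans (rotate-fan 0<l) (F-colour (<l⇒<i 0<l)))

        finish : ∀ {d a} → Proper d → (∀ g → is-just (d g) ≡ is-just (rotate l g)) →
                 Missing d x a → Missing d (y (F l)) a → ∃[ d′ ] Extends c d′ e₀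
        finish {d} {a} proper-d same-support missing-x missing-y = d [ F l ≔ just a ] , record
          { proper  = colour-proper proper-d ends-missing
          ; colours = colours
          ; agrees  = agrees
          }
          where
          ends-missing : ∀ v → Incident (F l) v → Missing d v a
          ends-missing v Fl-v with incident⇒≡∨otherEnd (F-incident l≤i) Fl-v
          ... | inj₁ refl = missing-x
          ... | inj₂ refl = missing-y

          colours : Coloured (d [ F l ≔ just a ]) e₀
          colours with e₀ ≟ F l
          ... | yes e₀≡Fl = subst (Coloured (d [ F l ≔ just a ])) (sym e₀≡Fl) (cong is-just (≔-updates d (F l)))
          ... | no e₀≢Fl =
            trans (cong is-just (≔-minimal d e₀≢Fl))
                  (trans (same-support e₀) (rotate-colours-e₀ (n≢0⇒n>0 (e₀≢Fl ∘ cong F ∘ sym))))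

          agrees : ∀ g → g ≢ e₀ → is-just ((d [ F l ≔ just a ]) g) ≡ is-just (c g)
          agrees g g≢e₀ with g ≟ F l
          ... | yes refl = trans (cong is-just (≔-updates d (F l))) (sym (F-coloured l≤i g≢e₀))
          ... | no g≢Fl  = trans (cong is-just (≔-minimal d g≢Fl))
                                 (trans (same-support g) (rotate-coloured g≢e₀ g≢Fl))

      blocked : next (F i) ≡ nothing → ∃[ d ] Extends c d e₀
      blocked stuck = finish ≤-refl (rotate-proper ≤-refl) (λ _ → refl)
                        (rotate-missing-x ≤-refl (edgeAt-nothing stuck))
                        (rotate-missing-y ≤-refl ≤-refl ≤-refl (free-missing _))

      -- The colour β missing at y (F i) is also missing at y (F j) (after rotating up to j), so
      -- one of these two vertices lies off the α/β-chain from x.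
      module Closing {j : ℕ} (j<i : j < i) (closes : next (F i) ≡ just (F (suc j))) where

        α β : Fin k
        α = free x
        β = free (y (F i))

        j≤i : j ≤ i
        j≤i = <⇒≤ j<i

        Fj-colour : c (F (suc j)) ≡ just β
        Fj-colour = proj₂ (edgeAt-just closes)

        α≢β : α ≢ β
        α≢β α≡β = free-missing x (F (suc j)) (F-incident j<i) (trans Fj-colour (cong just (sym α≡β)))

        yj-missing : Missing (rotate j) (y (F j)) β
        yj-missing = rotate-missing-y j≤i ≤-refl j≤i
                       (subst (Missing c _) (just-injective (trans (sym (F-colour j<i)) Fj-colour)) (free-missing _))

        open Kempe α β
        open KempeChain (kempeChain (rotate-proper j≤i) (rotate-loopless j≤i) α≢β
                                    (rotate-missing-x j≤i (free-missing x)))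

        outside : Fin n → Bool
        outside = not ∘ member

        x-inside : ¬ T (outside x)
        x-inside x-out = subst T (to T-not-≡ x-out) contains-x

        -- after swapping α and β off the chain, α is missing at x and at y (F l)
        swap-outside : ∀ {l} → l ≤ i → Closed (rotate l) outside → T (outside (y (F l))) →
                       Missing (rotate l) (y (F l)) β → ∃[ d ] Extends c d e₀
        swap-outside l≤i closed y-out y-missing =
          finish l≤i (kempeSwap-proper closed (rotate-proper l≤i)) (kempeSwap-coloured {S = outside})
                 (kempeSwap-missing-outside closed x-inside (rotate-missing-x l≤i (free-missing x)))
                 (kempeSwap-missing-inside closed y-out y-missing)

        pair-colour-stable : ∀ {e a} → rotate i e ≡ just a → InPair a → e ≡ F j ⊎ rotate j e ≡ just a
        pair-colour-stable {e} re pair with rotate-just ≤-refl re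
        ... | inj₂ (∉fan , ce) =
          inj₂ (trans (rotate-other j≤i (λ (t , t≤j , Ft≡e) → ∉fan (t , ≤-trans t≤j j≤i , Ft≡e))) ce)
        ... | inj₁ (t , t<i , refl , cF) with <-cmp t j
        ...   | tri< t<j _ _ = inj₂ (trans (rotate-fan j≤i t<j) cF)
        ...   | tri≈ _ refl _ = inj₁ refl
        ...   | tri> _ _ j<t = ⊥-elim (beyond pair)
          where
          beyond : InPair _ → ⊥
          beyond (inj₁ refl) = free-missing x (F (suc t)) (F-incident t<i) cF
          beyond (inj₂ refl) = proper (F (suc t)) (F (suc j)) (<⇒≢ (s≤s j<t) ∘ sym ∘ injective t<i j<i)
                                      (F-incident t<i) (F-incident j<i) cF Fj-colour

        outside-closed-at-i : T (member (y (F j))) → Closed (rotate i) outside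
        outside-closed-at-i yj-in e re pair e-u e-v u-out with pair-colour-stable re pair
        ... | inj₂ rj = closed-complement closed e rj pair e-u e-v u-out
        ... | inj₁ refl with incident⇒≡∨otherEnd (F-incident j≤i) e-u
        ...   | inj₁ refl = contradiction u-out x-inside
        ...   | inj₂ refl = ⊥-elim (subst T (to T-not-≡ u-out) yj-in)

        extension : ∃[ d ] Extends c d e₀
        extension with member (y (F j)) in yj-member
        ... | false = swap-outside j≤i (closed-complement closed) (subst (T ∘ not) (sym yj-member) tt) yj-missing
        ... | true  = swap-outside ≤-refl (outside-closed-at-i (subst T (sym yj-member) tt)) yi-out
                        (rotate-missing-y ≤-refl ≤-refl ≤-refl (free-missing _))
          where
          -- y (F i) also misses β, so it cannot be the second end of the chain
          yi-out : T (outside (y (F i)))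
          yi-out with member (y (F i)) in yi-member
          ... | false = tt
          ... | true  = <⇒≢ j<i (sym (y-injective ≤-refl j≤i
                          (one-end (subst T (sym yi-member) tt) (subst T (sym yj-member) tt)
                                   (y≢x ≤-refl) (y≢x j≤i)
                                   (inj₂ (rotate-missing-y j≤i j≤i ≤-refl (free-missing _)))
                                   (inj₂ yj-missing))))

      grow : ∀ {g} → next (F i) ≡ just g → ¬ InFan i g → IsFan (suc i)
      grow {g} found new = record { next-F = next-F′ ; injective = injective′ }
        where
        F-new : F (suc i) ≡ g
        F-new rewrite found = refl

        next-F′ : ∀ {t} → t < suc i → next (F t) ≡ just (F (suc t))
        next-F′ t<1+i with m≤n⇒m<n∨m≡n (≤-pred t<1+i)
        ... | inj₁ t<i  = next-F t<i
        ... | inj₂ refl = trans found (cong just (sym F-new))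

        injective′ : ∀ {s t} → s ≤ suc i → t ≤ suc i → F s ≡ F t → s ≡ t
        injective′ s≤1+i t≤1+i Fs≡Ft with m≤n⇒m<n∨m≡n s≤1+i | m≤n⇒m<n∨m≡n t≤1+i
        ... | inj₁ s<1+i | inj₁ t<1+i = injective (≤-pred s<1+i) (≤-pred t<1+i) Fs≡Ft
        ... | inj₂ refl  | inj₂ refl  = refl
        ... | inj₂ refl  | inj₁ t<1+i = contradiction (_ , ≤-pred t<1+i , trans (sym Fs≡Ft) F-new) new
        ... | inj₁ s<1+i | inj₂ refl  = contradiction (_ , ≤-pred s<1+i , trans Fs≡Ft F-new) new

    fan-or-extension : ∀ i → IsFan i ⊎ ∃[ d ] Extends c d e₀
    fan-or-extension zero = inj₁ record { next-F = λ () ; injective = λ { z≤n z≤n _ → refl } }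
    fan-or-extension (suc i) with fan-or-extension i
    ... | inj₂ done = inj₂ done
    ... | inj₁ fan with next (F i) in found
    ...   | nothing = inj₂ (blocked fan found)
    ...   | just g with inFan? i g
    ...     | no new                    = inj₁ (grow fan found new)
    ...     | yes (zero , _ , refl)     = contradiction (trans (sym e₀-uncoloured) (proj₂ (edgeAt-just found))) λ ()
    ...     | yes (suc j , j<i , refl)  = inj₂ (Closing.extension fan j<i found)

    no-fan-of-length-m : ¬ IsFan m
    no-fan-of-length-m fan with pigeonhole (n<1+n m) (λ t → F (toℕ t))
    ... | s , t , s<t , Fs≡Ft = <⇒≢ s<t (IsFan.injective fan (toℕ≤pred[n] s) (toℕ≤pred[n] t) Fs≡Ft)

    extension : ∃[ d ] Extends c d e₀
    extension with fan-or-extension m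
    ... | inj₁ fan  = contradiction fan no-fan-of-length-m
    ... | inj₂ done = done

  extend-at-simple-edge : ∀ {c} → Proper c → (∀ v → ∃[ a ] Missing c v a) →
                          (∀ g → Coloured c g → Simple g) →
                          ∀ {e} → c e ≡ nothing → Simple e → ∃[ d ] Extends c d e
  extend-at-simple-edge proper missing coloured⇒simple uncoloured simple =
    Fan.extension proper missing coloured⇒simple uncoloured simple

module LineGraphColouring (H : Multigraph) where

  G : Graph
  G = lineGraph H

  open PartialColouring H (Δ₂ G + 3) public
  open Vizing H (Δ₂ G + 3)

  edges-at-vertex≤2+Δ₂ : ∀ v → AtMost (2 + Δ₂ G) (λ e → Incident e v)
  edges-at-vertex≤2+Δ₂ v f f-injective at-v =
    clique⇒size≤2+Δ₂ G f f-injective λ s t s≢t →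
      from (T-adj (f s) (f t)) (s≢t ∘ f-injective , v , at-v s , at-v t)

  missing-colour : ∀ c v → ∃[ a ] Missing c v a
  missing-colour c v =
    unused-colour (λ e → incident? e v) c (edges-at-vertex≤2+Δ₂ v) (≤-reflexive (+-comm 3 (Δ₂ G)))

  -- a non-simple edge is dominated by an edge covering its ends, or is a loop without neighbours
  nonSimple⇒degree≤1+Δ₂ : ∀ e → ¬ Simple e → AtMost (1 + Δ₂ G) (T ∘ Graph.adj G e)
  nonSimple⇒degree≤1+Δ₂ e ¬simple
    with any? (λ h → ¬? (h ≟ e) ×-dec all? (λ v → incident? e v →-dec incident? h v))
  ... | yes (h , h≢e , covers) = dominated⇒degree≤1+Δ₂ G (≢-sym h≢e) dominates
    where
    dominates : Dominates G h e
    dominates w e~w w≢h with to (T-adj e w) e~w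
    ... | _ , v , e-v , w-v = from (T-adj h w) (≢-sym w≢h , v , covers v e-v , w-v)
  ... | no ∄cover = isolated
    where
    loop : Loop e
    loop with end₁ e ≟ end₂ e
    ... | yes e₁≡e₂ = e₁≡e₂
    ... | no e₁≢e₂  = contradiction (e₁≢e₂ , λ h h≢e covers → ∄cover (h , h≢e , covers)) ¬simple

    loop-end : ∀ {v} → Incident e v → end₁ e ≡ v
    loop-end (inj₁ e₁≡v) = e₁≡v
    loop-end (inj₂ e₂≡v) = trans loop e₂≡v

    no-nbr : ∀ g → ¬ T (Graph.adj G e g)
    no-nbr g e~g with to (T-adj e g) e~g
    ... | e≢g , v , e-v , g-v =
      ∄cover (g , ≢-sym e≢g , λ w e-w → subst (Incident g) (trans (sym (loop-end e-v)) (loop-end e-w)) g-v)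

    isolated : AtMost (1 + Δ₂ G) (T ∘ Graph.adj G e)
    isolated {zero}  _ _ _   = z≤n
    isolated {suc _} f _ nbr = ⊥-elim (no-nbr (f zero) (nbr zero))

  extend-at-nonSimple-edge : ∀ {c e} → Proper c → c e ≡ nothing → ¬ Simple e → ∃[ d ] Extends c d e
  extend-at-nonSimple-edge {c} {e} proper uncoloured ¬simple
    with unused-colour (T? ∘ Graph.adj G e) c (nonSimple⇒degree≤1+Δ₂ e ¬simple)
                       (≤-trans (n≤1+n _) (≤-reflexive (+-comm 3 (Δ₂ G))))
  ... | a , unused = c [ e ≔ just a ] , record
    { proper  = colour-proper proper missing
    ; colours = cong is-just (≔-updates c e)
    ; agrees  = λ g g≢e → cong is-just (≔-minimal c g≢e)
    }
    where
    missing : ∀ v → Incident e v → Missing c v a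
    missing v e-v g g-v cg with g ≟ e
    ... | yes refl = contradiction (trans (sym uncoloured) cg) λ ()
    ... | no g≢e   = unused g (from (T-adj e g) (≢-sym g≢e , v , e-v , g-v)) cg

  SimpleOnly : Colouring → Set
  SimpleOnly c = Proper c × (∀ g → Coloured c g → Simple g)

  colour-simple-edges : ∃[ c ] SimpleOnly c × (∀ e → Simple e → Coloured c e)
  colour-simple-edges = colour-all SimpleOnly simple? extend {c = λ _ → nothing} ((λ _ _ _ _ _ ()) , λ _ ())
    where
    extend : ∀ {c e} → SimpleOnly c → Simple e → c e ≡ nothing → ∃[ d ] SimpleOnly d × Extends c d e
    extend (proper , only-simple) simple uncoloured
      with extend-at-simple-edge proper (missing-colour _) only-simple uncoloured simple
    ... | d , ext = d , (Extends.proper ext , only-simple′) , ext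
      where
      only-simple′ : ∀ g → Coloured d g → Simple g
      only-simple′ g dg with extends-only ext dg
      ... | inj₁ cg   = only-simple g cg
      ... | inj₂ refl = simple

  SimpleDone : Colouring → Set
  SimpleDone c = Proper c × (∀ e → Simple e → Coloured c e)

  colour-nonSimple-edges : ∀ {c} → SimpleDone c → ∃[ d ] SimpleDone d × (∀ e → ¬ Simple e → Coloured d e)
  colour-nonSimple-edges = colour-all SimpleDone (¬? ∘ simple?) extend
    where
    extend : ∀ {c e} → SimpleDone c → ¬ Simple e → c e ≡ nothing → ∃[ d ] SimpleDone d × Extends c d e
    extend (proper , simple-coloured) ¬simple uncoloured with extend-at-nonSimple-edge proper uncoloured ¬simple
    ... | d , ext = d , (Extends.proper ext , λ g simple → extends-keeps ext (simple-coloured g simple)) , ext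

lemma4p2 : (H : Multigraph) → Colourable (lineGraph H) (Δ₂ (lineGraph H) + 3)
lemma4p2 H =
  let _ , (proper₁ , _) , simple-coloured₁ = colour-simple-edges
      _ , (proper , simple-coloured) , nonSimple-coloured = colour-nonSimple-edges (proper₁ , simple-coloured₁)
  in total⇒colourable proper (λ e → [ simple-coloured e , nonSimple-coloured e ]′ (toSum (simple? e)))
  where open LineGraphColouring H
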